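{- (1) SL does not have the decision-tree model property; (2) SL is not invariant under decision-unwinding. That is, there exist an SL sentence $\varphi$ and a CGS $\mathcal{G}$ with decision-unwinding $\mathcal{G}_{DU}$ such that it is not the case that ($\mathcal{G}\models\varphi$ iff $\mathcal{G}_{DU}\models\varphi$).
   Context: A concurrent game structure (CGS) is a tuple $\mathcal{G}=(\mathrm{AP},\mathrm{Ag},\mathrm{Ac},\mathrm{St},\lambda,\tau,s_0)$ with $\mathrm{AP},\mathrm{Ag}$ finite non-empty, $\mathrm{Ac},\mathrm{St}$ countable non-empty, $s_0\in\mathrm{St}$, $\lambda:\mathrm{St}\to2^{\mathrm{AP}}$, $\tau:\mathrm{St}\times\mathrm{Dc}\to\mathrm{St}$, $\mathrm{Dc}=\mathrm{Ac}^{\mathrm{Ag}}$. Tracks are non-empty finite state sequences following $\tau$; strategies are partial maps from tracks to actions ($s$-total if defined exactly on tracks starting at $s$); assignments are partial maps from $\mathrm{Var}\cup\mathrm{Ag}$ to strategies. For a complete $s$-total assignment $\chi$, the play from $s$ is $\pi_0=s$, $\pi_{i+1}=\tau(\pi_i,d_i)$ with $d_i(a)=\chi(a)(\pi_0\cdots\pi_i)$, and $(\chi,s)^i=(\chi_{\pi_0\cdots\pi_i},\pi_i)$ where each strategy $f$ is translated by $f_\rho(\mathrm{last}(\rho)\cdot\rho')=f(\rho\cdot\rho')$. Strategy Logic (SL) formulas: $\varphi::=p\mid\neg\varphi\mid\varphi\wedge\varphi\mid\varphi\vee\varphi\mid X\varphi\mid\varphi U\varphi\mid\varphi R\varphi\mid\langle\langle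 x\rangle\rangle\varphi\mid[[x]]\varphi\mid(a,x)\varphi$. Semantics: $\langle\langle x\rangle\rangle\varphi$ (resp. $[[x]]\varphi$) holds at $s$ under $\chi$ iff for some (resp. every) $s$-total strategy $f$, $\varphi$ holds under $\chi[x\mapsto f]$; $(a,x)\varphi$ holds iff $\varphi$ holds under $\chi[a\mapsto\chi(x)]$; with complete $\chi$, $X,U,R$ are evaluated as in LTL along $(\chi,s)^0,(\chi,s)^1,\ldots$. A sentence has no free agents or free variables; $\mathcal{G}\models\varphi$ iff $\varphi$ holds at $s_0$ under the empty assignment. A decision tree (DT) is a CGS $(\mathrm{AP},\mathrm{Ag},\mathrm{Ac},\mathrm{Dc}^*,\lambda,\tau,\varepsilon)$ with $\tau(t,d)=t\cdot d$. The decision-unwinding of $\mathcal{G}$ is the DT $\mathcal{G}_{DU}=(\mathrm{AP},\mathrm{Ag},\mathrm{Ac}_{\mathcal{G}},\mathrm{Dc}_{\mathcal{G}}^*,\lambda,\tau,\varepsilon)$ for which there is a surjective $\mathrm{unw}:\mathrm{Dc}_{\mathcal{G}}^*\to\mathrm{St}_{\mathcal{G}}$ with $\mathrm{unw}(\varepsilon)=s_0$, $\mathrm{unw}(\tau(t,d))=\tau_{\mathcal{G}}(\mathrm{unw}(t),d)$, $\lambda(t)=\lambda_{\mathcal{G}}(\mathrm{unw}(t))$. A sentence $\varphi$ has the decision-tree model property if for each CGS $\mathcal{G}$, $\mathcal{G}\models\varphi$ iff $\mathcal{G}_{DU}\models\varphi$; a logic has this property (is invariant under decision-unwinding) if all its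 sentences do. -}

module Defs where

open import Data.Nat using (ℕ; zero; suc)
open import Data.Fin using (Fin)
open import Data.Fin.Subset using (Subset; _∈_)
open import Data.List using (List; []; _∷_; _++_; [_]; _∷ʳ_; foldl)
open import Data.Maybe using (Maybe; just; nothing)
import Data.Maybe as Maybe
open import Data.Product using (Σ; _×_; _,_; ∃)
open import Data.Sum using (_⊎_)
open import Data.Empty using (⊥)
open import Relation.Nullary using (¬_; Dec; yes; no)
open import Relation.Binary.PropositionalEquality using (_≡_; _≢_; refl; cong)
open import Function.Definitions using (Injective)
open import Function.Bundles using (_⇔_)
import Data.Nat as ℕ
import Data.Fin as F

data Name (Ag : Set) : Set where
  var : ℕ → Name Ag
  agt : Ag → Name Ag

data Formula (AP Ag : Set) : Set where
  atom    : AP → Formula AP Ag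
  neg     : Formula AP Ag → Formula AP Ag
  conj    : Formula AP Ag → Formula AP Ag → Formula AP Ag
  disj    : Formula AP Ag → Formula AP Ag → Formula AP Ag
  next    : Formula AP Ag → Formula AP Ag
  until   : Formula AP Ag → Formula AP Ag → Formula AP Ag
  release : Formula AP Ag → Formula AP Ag → Formula AP Ag
  exs     : ℕ → Formula AP Ag → Formula AP Ag
  all     : ℕ → Formula AP Ag → Formula AP Ag
  bind    : Ag → ℕ → Formula AP Ag → Formula AP Ag

data Free {AP Ag : Set} : Name Ag → Formula AP Ag → Set where
  f-neg   : ∀ {z φ} → Free z φ → Free z (neg φ)
  f-conjˡ : ∀ {z φ ψ} → Free z φ → Free z (conj φ ψ)
  f-conjʳ : ∀ {z φ ψ} → Free z ψ → Free z (conj φ ψ)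
  f-disjˡ : ∀ {z φ ψ} → Free z φ → Free z (disj φ ψ)
  f-disjʳ : ∀ {z φ ψ} → Free z ψ → Free z (disj φ ψ)
  f-nextᵃ : ∀ {a φ} → Free (agt a) (next φ)
  f-next  : ∀ {z φ} → Free z φ → Free z (next φ)
  f-untilᵃ : ∀ {a φ ψ} → Free (agt a) (until φ ψ)
  f-untilˡ : ∀ {z φ ψ} → Free z φ → Free z (until φ ψ)
  f-untilʳ : ∀ {z φ ψ} → Free z ψ → Free z (until φ ψ)
  f-releaseᵃ : ∀ {a φ ψ} → Free (agt a) (release φ ψ)
  f-releaseˡ : ∀ {z φ ψ} → Free z φ → Free z (release φ ψ)
  f-releaseʳ : ∀ {z φ ψ} → Free z ψ → Free z (release φ ψ)
  f-exs   : ∀ {z x φ} → Free z φ → z ≢ var x → Free z (exs x φ)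
  f-all   : ∀ {z x φ} → Free z φ → z ≢ var x → Free z (all x φ)
  f-bind  : ∀ {z a x φ} → Free z φ → z ≢ agt a → Free z (bind a x φ)
  f-bindᵛ : ∀ {a x φ} → Free (agt a) φ → Free (var x) (bind a x φ)

Sentence : {AP Ag : Set} → Formula AP Ag → Set
Sentence φ = ∀ z → ¬ Free z φ

record Structure : Set₁ where
  field
    nAP : ℕ              -- AP = Fin (suc nAP)   (finite, non-empty)
    nAg : ℕ              -- Ag = Fin (suc nAg)   (finite, non-empty)
    Ac  : Set
    ac₀ : Ac
    St  : Set
    lab : St → Subset (suc nAP)
    tr  : St → (Fin (suc nAg) → Ac) → St
    s₀  : St

  AP : Set
  AP = Fin (suc nAP)

  Ag : Set
  Ag = Fin (suc nAg)

  Dc : Set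
  Dc = Ag → Ac

Countable : Set → Set
Countable A = Σ (A → ℕ) (λ f → Injective _≡_ _≡_ f)

record CGS : Set₁ where
  field
    structure   : Structure
    countableAc : Countable (Structure.Ac structure)
    countableSt : Countable (Structure.St structure)
  open Structure structure public

module Semantics (G : Structure) where
  open Structure G

  lastSt : St → List St → St
  lastSt s []      = s
  lastSt s (x ∷ w) = lastSt x w

  data IsTrackFrom (s : St) : List St → Set where
    []   : IsTrackFrom s []
    step : ∀ {s' w} (d : Dc) → tr s d ≡ s' → IsTrackFrom s' w → IsTrackFrom s (s' ∷ w)

  ++-track : ∀ {s u w} → IsTrackFrom s u → IsTrackFrom (lastSt s u) w → IsTrackFrom s (u ++ w)
  ++-track []           q = q
  ++-track (step d e p) q = step d e (++-track p q)

  -- An s-total strategy: a map from the tracks s·w (starting at s) to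
  -- actions.  The track proof is irrelevant, so the strategy depends
  -- only on the state sequence.
  Strat : St → Set
  Strat s = (w : List St) → .(IsTrackFrom s w) → Ac

  translate : ∀ {s} (u : List St) → .(IsTrackFrom s u) → Strat s → Strat (lastSt s u)
  translate u p f w q = f (u ++ w) (++-track p q)

  _≟N_ : (m n : Name Ag) → Dec (m ≡ n)
  var x ≟N var y with x ℕ.≟ y
  ... | yes refl = yes refl
  ... | no ne    = no λ { refl → ne refl }
  var x ≟N agt b = no λ ()
  agt a ≟N var y = no λ ()
  agt a ≟N agt b with a F.≟ b
  ... | yes refl = yes refl
  ... | no ne    = no λ { refl → ne refl }

  Assignment : St → Set
  Assignment s = Name Ag → Maybe (Strat s)

  _[_↦_] : ∀ {s} → Assignment s → Name Ag → Maybe (Strat s) → Assignment s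
  (χ [ n ↦ v ]) m with m ≟N n
  ... | yes _ = v
  ... | no  _ = χ m

  translateA : ∀ {s} (u : List St) → .(IsTrackFrom s u) → Assignment s → Assignment (lastSt s u)
  translateA u p χ n = Maybe.map (translate u p) (χ n)

  -- pre σ i = π₁ ⋯ π_i of the play π from s determined by the
  -- complete assignment of agents σ (π₀ = s); preTrack: it is a track.
  mutual
    pre : ∀ {s} → (Ag → Strat s) → ℕ → List St
    pre     σ zero    = []
    pre {s} σ (suc i) = pre σ i ++ [ tr (lastSt s (pre σ i)) (dec σ i) ]

    dec : ∀ {s} → (Ag → Strat s) → ℕ → Dc
    dec σ i a = σ a (pre σ i) (preTrack σ i)

    preTrack : ∀ {s} (σ : Ag → Strat s) (i : ℕ) → IsTrackFrom s (pre σ i)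
    preTrack σ zero    = []
    preTrack σ (suc i) = ++-track (preTrack σ i) (step (dec σ i) refl [])

  Agents : ∀ {s} → Assignment s → (Ag → Strat s) → Set
  Agents χ σ = ∀ a → χ (agt a) ≡ just (σ a)

  mutual
    sat : (s : St) → Assignment s → Formula AP Ag → Set
    sat s χ (atom p)        = p ∈ lab s
    sat s χ (neg φ)         = ¬ sat s χ φ
    sat s χ (conj φ ψ)      = sat s χ φ × sat s χ ψ
    sat s χ (disj φ ψ)      = sat s χ φ ⊎ sat s χ ψ
    sat s χ (next φ)        = (σ : Ag → Strat s) → Agents χ σ → satAt s χ σ 1 φ
    sat s χ (until φ ψ)     = (σ : Ag → Strat s) → Agents χ σ →
      Σ ℕ λ i → satAt s χ σ i ψ × ((j : ℕ) → j ℕ.< i → satAt s χ σ j φ)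
    sat s χ (release φ ψ)   = (σ : Ag → Strat s) → Agents χ σ →
      (i : ℕ) → satAt s χ σ i ψ ⊎ (Σ ℕ λ j → j ℕ.< i × satAt s χ σ j φ)
    sat s χ (exs x φ)       = Σ (Strat s) λ f → sat s (χ [ var x ↦ just f ]) φ
    sat s χ (all x φ)       = (f : Strat s) → sat s (χ [ var x ↦ just f ]) φ
    sat s χ (bind a x φ)    = sat s (χ [ agt a ↦ χ (var x) ]) φ

    satAt : (s : St) → Assignment s → (Ag → Strat s) → ℕ → Formula AP Ag → Set
    satAt s χ σ i φ =
      sat (lastSt s (pre σ i)) (translateA (pre σ i) (preTrack σ i) χ) φ

  ∅ : Assignment s₀
  ∅ _ = nothing

  ⊨ : Formula AP Ag → Set
  ⊨ φ = sat s₀ ∅ φ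

_⊨_ : (G : Structure) → Formula (Structure.AP G) (Structure.Ag G) → Set
G ⊨ φ = Semantics.⊨ G φ

unw : (G : Structure) → List (Structure.Dc G) → Structure.St G
unw G t = foldl (Structure.tr G) (Structure.s₀ G) t

-- G_DU exists (unw surjective) iff every state is reachable
UnwSurjective : Structure → Set
UnwSurjective G = ∀ (s : Structure.St G) → Σ (List (Structure.Dc G)) λ t → unw G t ≡ s

DU : Structure → Structure
DU G = record
  { nAP = nAP
  ; nAg = nAg
  ; Ac  = Ac
  ; ac₀ = ac₀
  ; St  = List Dc
  ; lab = λ t → lab (unw G t)
  ; tr  = λ t d → t ∷ʳ d
  ; s₀  = []
  }
  where open Structure G

-- The witness is ∃x ∀y ((A,y)(B,y) X q ↔ (A,x)(B,y) X X p): some strategy x,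
-- playing for A in the second round, reproduces the opening move of every y.
-- In G, when A opens with false the play reaches s₁ whatever B does, so x's
-- second move cannot depend on B's opening move and y can be chosen to disagree
-- with it.  In the decision-unwinding the node reached records the whole first
-- decision, so x can copy B's opening move.
module Submission where

open import Defs
open import Data.Bool using (Bool; true; false; not; _∧_)
open import Data.Bool.Properties using (∧-idem; not-¬)
open import Data.Empty using (⊥-elim)
open import Data.Fin using (Fin; zero; suc)
open import Data.Fin.Subset using (Subset; inside; outside; _∈_)
open import Data.List using (List; []; _∷_; _∷ʳ_)
open import Data.Maybe using (just)
import Data.Maybe as Maybe
open import Data.Maybe.Properties using (just-injective)
open import Data.Nat using (ℕ)
open import Data.Product using (Σ; _×_; _,_)
open import Data.Sum using (_⊎_; inj₁; inj₂; [_,_]′)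
open import Data.Vec using (_∷_; []; here; there)
open import Function.Bundles using (_⇔_; Equivalence)
open import Relation.Binary.PropositionalEquality
  using (_≡_; refl; sym; trans; cong; cong₂; subst; module ≡-Reasoning)
open import Relation.Nullary using (¬_)
open import Relation.Nullary.Reflects using (Reflects; ofʸ; ofⁿ; invert)

uniform-∀-reflects : {X : Set} {Y : X → Set} {P : X → Set} {b : Bool} →
                     Σ X Y → (∀ x → Y x → Reflects (P x) b) →
                     Reflects (∀ x → Y x → P x) b
uniform-∀-reflects {b = true}  _       r = ofʸ λ x y → invert (r x y)
uniform-∀-reflects {b = false} (x , y) r = ofⁿ λ h → invert (r x y) (h x y)

both-or-neither : {P Q : Set} {b : Bool} →
                  Reflects P b → Reflects Q b → (P × Q) ⊎ (¬ P × ¬ Q)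
both-or-neither (ofʸ p)  (ofʸ q)  = inj₁ (p , q)
both-or-neither (ofⁿ ¬p) (ofⁿ ¬q) = inj₂ (¬p , ¬q)

both-or-neither⇒≡ : {P Q : Set} {b c : Bool} → Reflects P b → Reflects Q c →
                     (P × Q) ⊎ (¬ P × ¬ Q) → b ≡ c
both-or-neither⇒≡ (ofʸ _)  (ofʸ _)  _                = refl
both-or-neither⇒≡ (ofⁿ ¬p) (ofʸ _)  (inj₁ (p , _))   = ⊥-elim (¬p p)
both-or-neither⇒≡ (ofⁿ _)  (ofʸ q)  (inj₂ (_ , ¬q))  = ⊥-elim (¬q q)
both-or-neither⇒≡ (ofʸ _)  (ofⁿ ¬q) (inj₁ (_ , q))   = ⊥-elim (¬q q)
both-or-neither⇒≡ (ofʸ p)  (ofⁿ _)  (inj₂ (¬p , _))  = ⊥-elim (¬p p)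
both-or-neither⇒≡ (ofⁿ _)  (ofⁿ _)  _                = refl

retraction⇒countable : {A : Set} (encode : A → ℕ) (decode : ℕ → A) →
                       (∀ a → decode (encode a) ≡ a) → Countable A
retraction⇒countable encode decode retract =
  encode , λ {a} {b} e → trans (sym (retract a)) (trans (cong decode e) (retract b))

module SemanticsFacts (H : Structure) where
  open Structure H using (Ag)
  open Semantics H public

  opening-move : ∀ {s} (σ : Ag → Strat s) {f : Strat s} a →
                 just f ≡ just (σ a) → dec σ 0 a ≡ f [] []
  opening-move σ a e = cong (λ g → g [] []) (sym (just-injective e))

  translate-agents : ∀ {s} {χ : Assignment s} {σ : Ag → Strat s}
                     (u : List _) .(p : IsTrackFrom s u) →
                     Agents χ σ → Agents (translateA u p χ) (λ a → translate u p (σ a))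
  translate-agents u p agents a = cong (Maybe.map (translate u p)) (agents a)

  strategy-cong : ∀ {s} (f : Strat s) {w w'} .{p : IsTrackFrom s w} .{p' : IsTrackFrom s w'} →
                  w ≡ w' → f w p ≡ f w' p'
  strategy-cong f refl = refl

Agent : Set
Agent = Fin 2

A B : Agent
A = zero
B = suc zero

p q : Fin 2
p = zero
q = suc zero

_⟺_ : {AP Ag : Set} → Formula AP Ag → Formula AP Ag → Formula AP Ag
φ ⟺ ψ = disj (conj φ ψ) (conj (neg φ) (neg ψ))

yOpensTrue xRepliesTrue : Formula (Fin 2) Agent
yOpensTrue   = bind A 1 (bind B 1 (next (atom q)))
xRepliesTrue = bind A 0 (bind B 1 (next (next (atom p))))

xPredictsY : Formula (Fin 2) Agent
xPredictsY = exs 0 (all 1 (yOpensTrue ⟺ xRepliesTrue))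

NoFreeVariable : {AP Ag : Set} → Formula AP Ag → Set
NoFreeVariable φ = ∀ x → ¬ Free (var x) φ

BoundBy : {Ag : Set} → ℕ → ℕ → Name Ag → Set
BoundBy u v z = z ≡ var u ⊎ z ≡ var v

FreeWithin : {AP Ag : Set} → (Name Ag → Set) → Formula AP Ag → Set
FreeWithin P φ = ∀ {z} → Free z φ → P z

atom-noFreeVariable : {AP Ag : Set} (a : AP) → NoFreeVariable {Ag = Ag} (atom a)
atom-noFreeVariable a x ()

next-noFreeVariable : {AP Ag : Set} {φ : Formula AP Ag} → NoFreeVariable φ → NoFreeVariable (next φ)
next-noFreeVariable h x (f-next free) = h x free

bind-both-freeWithin : {AP : Set} {P : Name Agent → Set} {φ : Formula AP Agent} {u v : ℕ} →
                       P (var u) → P (var v) → NoFreeVariable φ →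
                       FreeWithin P (bind A u (bind B v φ))
bind-both-freeWithin Pu Pv h (f-bindᵛ _)                          = Pu
bind-both-freeWithin Pu Pv h (f-bind (f-bindᵛ _) _)               = Pv
bind-both-freeWithin Pu Pv h {var x} (f-bind (f-bind free _) _)   = ⊥-elim (h x free)
bind-both-freeWithin Pu Pv h {agt zero} (f-bind _ z≢A)            = ⊥-elim (z≢A refl)
bind-both-freeWithin Pu Pv h {agt (suc zero)} (f-bind (f-bind _ z≢B) _) = ⊥-elim (z≢B refl)

⟺-freeWithin : {AP Ag : Set} {P : Name Ag → Set} {φ ψ : Formula AP Ag} →
               FreeWithin P φ → FreeWithin P ψ → FreeWithin P (φ ⟺ ψ)
⟺-freeWithin hφ hψ (f-disjˡ (f-conjˡ free))       = hφ free
⟺-freeWithin hφ hψ (f-disjˡ (f-conjʳ free))       = hψ free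
⟺-freeWithin hφ hψ (f-disjʳ (f-conjˡ (f-neg free))) = hφ free
⟺-freeWithin hφ hψ (f-disjʳ (f-conjʳ (f-neg free))) = hψ free

exs-all-sentence : {AP Ag : Set} {φ : Formula AP Ag} {u v : ℕ} →
                   FreeWithin (BoundBy u v) φ → Sentence (exs u (all v φ))
exs-all-sentence h z (f-exs (f-all free z≢v) z≢u) = [ z≢u , z≢v ]′ (h free)

xPredictsY-sentence : Sentence xPredictsY
xPredictsY-sentence = exs-all-sentence (⟺-freeWithin
  (bind-both-freeWithin {P = BoundBy 0 1} (inj₂ refl) (inj₂ refl)
    (next-noFreeVariable (atom-noFreeVariable q)))
  (bind-both-freeWithin {P = BoundBy 0 1} (inj₁ refl) (inj₂ refl)
    (next-noFreeVariable (next-noFreeVariable (atom-noFreeVariable p)))))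

booleanGame : {St : Set} → St → (St → (Agent → Bool) → St) → (St → Subset 2) → Structure
booleanGame {St} s move label = record
  { nAP = 1 ; nAg = 1 ; Ac = Bool ; ac₀ = false ; St = St ; lab = label ; tr = move ; s₀ = s }

-- Both G and its decision-unwinding are instances, so the witness is evaluated once.
module TwoRounds {St : Set} (s : St) (move : St → (Agent → Bool) → St) (label : St → Subset 2)
  (q-reflects : ∀ d → Reflects (q ∈ label (move s d)) (d A ∧ d B))
  (p-reflects : ∀ d d' → Reflects (p ∈ label (move (move s d) d')) (not (d A) ∧ d' A))
  where
  open SemanticsFacts (booleanGame s move label) public hiding (⊨)
  open ≡-Reasoning

  χ : Strat s → Strat s → Assignment s
  χ x y = (∅ [ var 0 ↦ just x ]) [ var 1 ↦ just y ]

  bindBoth : ℕ → ℕ → Assignment s → Assignment s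
  bindBoth u v χ' = χ₁ [ agt B ↦ χ₁ (var v) ]
    where χ₁ = χ' [ agt A ↦ χ' (var u) ]

  reply : Strat s → (Agent → Bool) → Bool
  reply x d = x (move s d ∷ []) (step d refl [])

  yOpensTrue-reflects : ∀ x y → Reflects (sat s (χ x y) yOpensTrue) (y [] [])
  yOpensTrue-reflects x y =
    uniform-∀-reflects ((λ _ → y) , λ { zero → refl ; (suc zero) → refl }) λ σ agents →
      subst (Reflects _) (opening σ agents) (q-reflects (dec σ 0))
    where
    opening : ∀ σ → Agents (bindBoth 1 1 (χ x y)) σ → dec σ 0 A ∧ dec σ 0 B ≡ y [] []
    opening σ agents = begin
      dec σ 0 A ∧ dec σ 0 B  ≡⟨ cong₂ _∧_ (opening-move σ A (agents A)) (opening-move σ B (agents B)) ⟩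
      y [] [] ∧ y [] []      ≡⟨ ∧-idem (y [] []) ⟩
      y [] []                ∎

  xRepliesTrue-reflects : ∀ {x y b} →
    (∀ d → d A ≡ x [] [] → d B ≡ y [] [] → not (x [] []) ∧ reply x d ≡ b) →
    Reflects (sat s (χ x y) xRepliesTrue) b
  xRepliesTrue-reflects {x} {y} {b} replies =
    uniform-∀-reflects (players , λ { zero → refl ; (suc zero) → refl }) λ σ agents →
      uniform-∀-reflects (_ , translate-agents {χ = bindBoth 0 1 (χ x y)} (pre σ 1) (preTrack σ 1) agents)
        λ σ' agents' →
        subst (Reflects _) (rounds σ agents σ' agents') (p-reflects (dec σ 0) (dec σ' 0))
    where
    players : Agent → Strat s
    players zero       = x
    players (suc zero) = y

    rounds : ∀ σ → Agents (bindBoth 0 1 (χ x y)) σ →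
             ∀ σ' → Agents (translateA (pre σ 1) (preTrack σ 1) (bindBoth 0 1 (χ x y))) σ' →
             not (dec σ 0 A) ∧ dec σ' 0 A ≡ b
    rounds σ agents σ' agents' = begin
      not (dec σ 0 A) ∧ dec σ' 0 A
        ≡⟨ cong₂ (λ u v → not u ∧ v) (opening-move σ A (agents A)) (opening-move σ' A (agents' A)) ⟩
      not (x [] []) ∧ reply x (dec σ 0)
        ≡⟨ replies (dec σ 0) (opening-move σ A (agents A)) (opening-move σ B (agents B)) ⟩
      b ∎

data State : Set where
  s₀ s₁ r₀ r₁ g₀ g₁ : State

transition : State → (Agent → Bool) → State
transition s₀ d with d A | d B
... | true  | true  = r₁
... | true  | false = r₀
... | false | _     = s₁
transition s₁ d with d A
... | true  = g₁
... | false = g₀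
transition s _ = s

label : State → Subset 2
label g₁ = inside ∷ outside ∷ []
label r₁ = outside ∷ inside ∷ []
label _  = outside ∷ outside ∷ []

q-after-one-round : ∀ d → Reflects (q ∈ label (transition s₀ d)) (d A ∧ d B)
q-after-one-round d with d A | d B
... | true  | true  = ofʸ (there here)
... | true  | false = ofⁿ λ { (there ()) }
... | false | _     = ofⁿ λ { (there ()) }

p-after-two-rounds : ∀ d d' → Reflects (p ∈ label (transition (transition s₀ d) d'))
                                       (not (d A) ∧ d' A)
p-after-two-rounds d d' with d A | d B
... | true  | true  = ofⁿ λ ()
... | true  | false = ofⁿ λ ()
... | false | _ with d' A
...   | true  = ofʸ here
...   | false = ofⁿ λ ()

Gs : Structure
Gs = booleanGame s₀ transition label

encode : State → ℕ
encode s₀ = 0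
encode s₁ = 1
encode r₀ = 2
encode r₁ = 3
encode g₀ = 4
encode g₁ = 5

decode : ℕ → State
decode 0 = s₀
decode 1 = s₁
decode 2 = r₀
decode 3 = r₁
decode 4 = g₀
decode _ = g₁

decode-encode : ∀ s → decode (encode s) ≡ s
decode-encode s₀ = refl
decode-encode s₁ = refl
decode-encode r₀ = refl
decode-encode r₁ = refl
decode-encode g₀ = refl
decode-encode g₁ = refl

encodeBool : Bool → ℕ
encodeBool false = 0
encodeBool true  = 1

decodeBool : ℕ → Bool
decodeBool 0 = false
decodeBool _ = true

decodeBool-encodeBool : ∀ b → decodeBool (encodeBool b) ≡ b
decodeBool-encodeBool false = refl
decodeBool-encodeBool true  = refl

G : CGS
G = record
  { structure   = Gs
  ; countableAc = retraction⇒countable encodeBool decodeBool decodeBool-encodeBool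
  ; countableSt = retraction⇒countable encode decode decode-encode
  }

decision : Bool → Bool → Agent → Bool
decision a b zero    = a
decision a b (suc _) = b

unw-surjective : UnwSurjective Gs
unw-surjective s₀ = [] , refl
unw-surjective s₁ = decision false false ∷ [] , refl
unw-surjective r₀ = decision true false ∷ [] , refl
unw-surjective r₁ = decision true true ∷ [] , refl
unw-surjective g₀ = decision false false ∷ decision false false ∷ [] , refl
unw-surjective g₁ = decision false false ∷ decision true false ∷ [] , refl

leaves-to-s₁ : ∀ {d} → d A ≡ false → transition s₀ d ≡ s₁
leaves-to-s₁ {d} dA with d A | d B
leaves-to-s₁ refl | false | _ = refl

module InG where
  open TwoRounds s₀ transition label q-after-one-round p-after-two-rounds

  track-s₁ : IsTrackFrom s₀ (s₁ ∷ [])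
  track-s₁ = step (decision false false) refl []

  -- A's second move is made at the same track s₀ s₁ whatever B opened with.
  reply-at-s₁ : (x : Strat s₀) → ∀ d → d A ≡ x [] [] →
                not (x [] []) ∧ reply x d ≡ not (x [] []) ∧ x (s₁ ∷ []) track-s₁
  reply-at-s₁ x d dA with x [] []
  ... | true  = refl
  ... | false = strategy-cong x (cong (_∷ []) (leaves-to-s₁ {d} dA))

  refutes : ¬ (Gs ⊨ xPredictsY)
  refutes (x , predicts) =
    not-¬ refl (sym (both-or-neither⇒≡ (yOpensTrue-reflects x y)
                                         (xRepliesTrue-reflects λ d dA _ → reply-at-s₁ x d dA)
                                         (predicts y)))
    where
    y : Strat s₀
    y _ _ = not (not (x [] []) ∧ x (s₁ ∷ []) track-s₁)

module InDU where
  open TwoRounds [] (λ t d → t ∷ʳ d) (λ t → label (unw Gs t)) q-after-one-round p-after-two-rounds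

  copyB : Strat []
  copyB ((d ∷ []) ∷ []) _ = d B
  copyB _               _ = false

  satisfies : DU Gs ⊨ xPredictsY
  satisfies = copyB , λ y →
    both-or-neither (yOpensTrue-reflects copyB y) (xRepliesTrue-reflects λ d _ dB → dB)

mainTheorem6 : Σ CGS λ G → Σ (Formula (CGS.AP G) (CGS.Ag G)) λ φ →
                 Sentence φ × UnwSurjective (CGS.structure G) ×
                 ¬ ((CGS.structure G ⊨ φ) ⇔ (DU (CGS.structure G) ⊨ φ))
mainTheorem6 = G , xPredictsY , xPredictsY-sentence , unw-surjective ,
  λ equivalent → InG.refutes (Equivalence.from equivalent InDU.satisfies)
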